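{- Let $t=s\sum_{y_0,\dots,y_k}e^{2i\pi P}|\vec O\rangle\langle\vec I|:n\to m$ be an SOP morphism whose phase polynomial is written as a sum of monomials $P=\sum_{i=1}^{\ell}m_i$. Let $A=s\sum_{y_0,\dots,y_k}|\vec O\rangle\langle y_0,\dots,y_k|:k+1\to m$, $D_i=\sum_{y_0,\dots,y_k}e^{2i\pi m_i}|y_0,\dots,y_k\rangle\langle y_0,\dots,y_k|:k+1\to k+1$ for $1\le i\le\ell$, and $B=\sum_{y_0,\dots,y_k}|y_0,\dots,y_k\rangle\langle\vec I|:n\to k+1$. Then the SOP morphism $A\circ D_1\circ\cdots\circ D_\ell\circ B$ rewrites to $t$ by finitely many applications of the rules (HH) and (Elim).
   Context: An SOP morphism $t:n\to m$ is a formal expression $t=s\sum_{\vec y\in V^k}e^{2i\pi P(\vec y)}|\vec O(\vec y)\rangle\langle\vec I(\vec y)|$ where $s\in\mathbb R$, $\vec y$ are distinct boolean summation variables, the phase polynomial $P$ lies in $\mathbb R[\vec y]/(y_j^2-y_j)$, $\vec O\in\mathbb F_2[\vec y]^m$, $\vec I\in\mathbb F_2[\vec y]^n$. Morphisms are identified up to renaming of summation variables, and phase polynomials are identified when their difference has integer coefficients. For $Q\in\mathbb F_2[\vec y]$, $\widehat Q$ is the real polynomial defined by $\widehat{Q_1Q_2}=\widehat{Q_1}\widehat{Q_2}$, $\widehat{Q_1\oplus Q_2}=\widehat{Q_1}+\widehat{Q_2}-2\widehat{Q_1}\widehat{Q_2}$, $\widehat{y_j}=y_j$, $\widehat0=0$,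 $\widehat1=1$. Composition: for $g=s_g\sum_{\vec y_g}e^{2i\pi P_g}|\vec O_g\rangle\langle\vec I_g|:n\to m$ and $f=s_f\sum_{\vec y_f}e^{2i\pi P_f}|\vec O_f\rangle\langle\vec I_f|:m\to\ell$ with disjoint variables (renamed if needed), $f\circ g=\frac{s_fs_g}{2^m}\sum_{\vec y_f,\vec y_g,\vec z}e^{2i\pi(P_g+P_f+\frac12(\widehat{\vec O_g}\cdot\vec z+\widehat{\vec I_f}\cdot\vec z))}|\vec O_f\rangle\langle\vec I_g|$ with $\vec z=(z_1,\dots,z_m)$ fresh and $\widehat{\vec O}\cdot\vec z=\sum_j\widehat{O_j}z_j$. $\mathrm{Var}(\cdot)$ denotes the set of variables occurring in a collection of polynomials, and $t[y\leftarrow Q]$ substitution of $Q$ for $y$ in $\vec O,\vec I$ and of $\widehat Q$ for $y$ in $P$. Rules: (Elim) $s\sum_{\vec y}e^{2i\pi P}|\vec O\rangle\langle\vec I|\to 2s\sum_{\vec y\setminus\{y_0\}}e^{2i\pi P}|\vec O\rangle\langle\vec I|$ if $y_0$ is a summation variable not in $\mathrm{Var}(P,\vec O,\vec I)$. (HH) $t=s\sum_{\vec y}e^{2i\pi(\frac{y_0}{2}(y_i+\widehat{Q'}+1)+R)}|\vec O\rangle\langle\vec I|\to t[y_i\leftarrow 1\oplus Q']$ with $y_i$ removed from the summation, provided $y_0\neq y_i$ are summation variables, $y_0\notin\mathrm{Var}(Q',R,\vec O,\vec I)$ and $y_i\notin\mathrm{Var}(Q')$ (equivalently: a phase term $\frac{y_0}{2}(y_i+\widehat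 Q)$ with $y_0$ occurring nowhere else lets one substitute $y_i\leftarrow Q$). -}

module Defs where

open import Level using (Level) renaming (_⊔_ to _⊔ˡ_)
open import Algebra.Bundles using (CommutativeRing)
open import Data.Bool using (Bool; true; false; _xor_; _∧_; if_then_else_)
open import Data.Nat using (ℕ; zero; suc) renaming (_+_ to _+ℕ_; _⊔_ to _⊔ℕ_; _≟_ to _≟ℕ_)
open import Data.Integer using (ℤ; +_; -[1+_])
open import Data.List using (List; []; _∷_; length; filter; _++_; foldr; map)
open import Data.List.Membership.Propositional using (_∈_; _∉_)
open import Data.List.Relation.Unary.Unique.Propositional using (Unique)
open import Data.List.Relation.Binary.Permutation.Propositional using (_↭_)
open import Data.Vec as Vec using (Vec)
open import Data.Fin using (Fin)
open import Data.Product using (∃; _×_; _,_)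
open import Data.Sum using (_⊎_)
open import Relation.Binary.PropositionalEquality using (_≡_; _≢_)
open import Relation.Nullary using (¬_; ¬?; does)
open import Relation.Binary.Construct.Closure.ReflexiveTransitive using (Star)
open import Function.Definitions using (Injective)

-- Syntax of polynomials in the variables y ∈ ℕ with coefficients in A.
-- Polynomials are identified semantically (see _≈₂_ and _≈ₚ_ below).

data Exp {a} (A : Set a) : Set a where
  con : A → Exp A
  var : ℕ → Exp A
  _⊞_ : Exp A → Exp A → Exp A
  _⊠_ : Exp A → Exp A → Exp A

module _ {a} {A : Set a} where

  varsE : Exp A → List ℕ
  varsE (con _)  = []
  varsE (var y)  = y ∷ []
  varsE (e ⊞ e') = varsE e ++ varsE e'
  varsE (e ⊠ e') = varsE e ++ varsE e'

  varsV : ∀ {k} → Vec (Exp A) k → List ℕ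
  varsV = Vec.foldr _ (λ e acc → varsE e ++ acc) []

  renameE : (ℕ → ℕ) → Exp A → Exp A
  renameE ρ (con c)  = con c
  renameE ρ (var y)  = var (ρ y)
  renameE ρ (e ⊞ e') = renameE ρ e ⊞ renameE ρ e'
  renameE ρ (e ⊠ e') = renameE ρ e ⊠ renameE ρ e'

  substE : ℕ → Exp A → Exp A → Exp A
  substE y Q (con c)  = con c
  substE y Q (var x)  = if does (x ≟ℕ y) then Q else var x
  substE y Q (e ⊞ e') = substE y Q e ⊞ substE y Q e'
  substE y Q (e ⊠ e') = substE y Q e ⊠ substE y Q e'

maxL : List ℕ → ℕ
maxL = foldr _⊔ℕ_ 0

remove : ℕ → List ℕ → List ℕ
remove y = filter (λ x → ¬? (x ≟ℕ y))

-- Polynomials of 𝔽₂[y]/(y²-y): expressions over Bool (⊞ = ⊕, ⊠ = product),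
-- identified when they agree as functions on all boolean assignments.

F2 : Set
F2 = Exp Bool

evalB : (ℕ → Bool) → F2 → Bool
evalB σ (con b)  = b
evalB σ (var y)  = σ y
evalB σ (e ⊞ e') = evalB σ e xor evalB σ e'
evalB σ (e ⊠ e') = evalB σ e ∧ evalB σ e'

_≈₂_ : F2 → F2 → Set
Q ≈₂ Q' = ∀ σ → evalB σ Q ≡ evalB σ Q'

_≈V_ : ∀ {k} → Vec F2 k → Vec F2 k → Set
u ≈V v = ∀ i → Vec.lookup u i ≈₂ Vec.lookup v i

idVec : (ys : List ℕ) → Vec F2 (length ys)
idVec ys = Vec.map var (Vec.fromList ys)

-- SOP morphisms with scalars / phase coefficients in a commutative ring R
-- (the paper uses R = ℝ), `half` standing for 1/2.

module SOPTheory {c ℓ} (R : CommutativeRing c ℓ) (half : CommutativeRing.Carrier R) where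
  open CommutativeRing R

  Phase : Set c
  Phase = Exp Carrier

  evalR : (ℕ → Bool) → Phase → Carrier
  evalR σ (con a)  = a
  evalR σ (var y)  = if σ y then 1# else 0#
  evalR σ (e ⊞ e') = evalR σ e + evalR σ e'
  evalR σ (e ⊠ e') = evalR σ e * evalR σ e'

  natR : ℕ → Carrier
  natR zero    = 0#
  natR (suc n) = 1# + natR n

  fromℤ : ℤ → Carrier
  fromℤ (+ n)    = natR n
  fromℤ -[1+ n ] = - natR (suc n)

  powR : Carrier → ℕ → Carrier
  powR a zero    = 1#
  powR a (suc k) = a * powR a k

  -- phase polynomials are identified when their difference has integer
  -- coefficients (as multilinear polynomials; equivalently, by Möbius
  -- inversion, when the difference is integer valued on {0,1}^ℕ)
  _≈ₚ_ : Phase → Phase → Set ℓ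
  P ≈ₚ P' = ∀ σ → ∃ λ (z : ℤ) → evalR σ P ≈ evalR σ P' + fromℤ z

  hat : F2 → Phase
  hat (con true)  = con 1#
  hat (con false) = con 0#
  hat (var y)     = var y
  hat (Q ⊞ Q')    = (hat Q ⊞ hat Q') ⊞ (con (- (1# + 1#)) ⊠ (hat Q ⊠ hat Q'))
  hat (Q ⊠ Q')    = hat Q ⊠ hat Q'

  -- s ∑_{svars} e^{2iπ phase} |out⟩⟨inp|  :  n → m
  record SOP (n m : ℕ) : Set c where
    constructor sop
    field
      scalar : Carrier
      svars  : List ℕ
      phase  : Phase
      out    : Vec F2 m
      inp    : Vec F2 n
  open SOP public

  allVars : ∀ {n m} → SOP n m → List ℕ
  allVars t = varsE (phase t) ++ varsV (out t) ++ varsV (inp t)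

  WF : ∀ {n m} → SOP n m → Set
  WF t = Unique (svars t) × (∀ y → y ∈ allVars t → y ∈ svars t)

  record _≅_ {n m} (t t' : SOP n m) : Set (c ⊔ˡ ℓ) where
    field
      ρ       : ℕ → ℕ
      ρ-inj   : Injective _≡_ _≡_ ρ
      scalar≈ : scalar t' ≈ scalar t
      svars↭  : map ρ (svars t) ↭ svars t'
      phase≈  : phase t' ≈ₚ renameE ρ (phase t)
      out≈    : out t' ≈V Vec.map (renameE ρ) (out t)
      inp≈    : inp t' ≈V Vec.map (renameE ρ) (inp t)

  -- composition f ∘ g (g : n → m, f : m → l), variables of g shifted
  -- above all variables of f and g, fresh z-variables above those
  zTerms : ∀ {k} → ℕ → Vec F2 k → Vec F2 k → Phase
  zTerms z Vec.[] Vec.[] = con 0#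
  zTerms z (o Vec.∷ os) (i Vec.∷ is) =
    (con half ⊠ ((hat o ⊞ hat i) ⊠ var z)) ⊞ zTerms (suc z) os is

  zList : ℕ → ℕ → List ℕ
  zList z zero    = []
  zList z (suc k) = z ∷ zList (suc z) k

  maxSOP : ∀ {n m} → SOP n m → ℕ
  maxSOP t = maxL (svars t ++ allVars t)

  _∘ˢ_ : ∀ {n m l} → SOP m l → SOP n m → SOP n l
  _∘ˢ_ {n} {m} {l} f g =
    sop (scalar f * scalar g * powR half m)
        (svars f ++ map sh (svars g) ++ zList (N +ℕ N) m)
        ((renameE sh (phase g) ⊞ phase f)
           ⊞ zTerms (N +ℕ N) (Vec.map (renameE sh) (out g)) (inp f))
        (out f)
        (Vec.map (renameE sh) (inp g))
    where
      N : ℕ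
      N = suc (maxSOP f ⊔ℕ maxSOP g)
      sh : ℕ → ℕ
      sh y = N +ℕ y

  data _⟶E_ {n m} : SOP n m → SOP n m → Set c where
    elim : ∀ s ys P O I y₀ →
           y₀ ∈ ys → y₀ ∉ (varsE P ++ varsV O ++ varsV I) →
           sop s ys P O I ⟶E sop ((1# + 1#) * s) (remove y₀ ys) P O I

  hhTerm : ℕ → ℕ → F2 → Phase
  hhTerm y₀ yᵢ Q' = (con half ⊠ var y₀) ⊠ ((var yᵢ ⊞ hat Q') ⊞ con 1#)

  data _⟶H_ {n m} : SOP n m → SOP n m → Set c where
    hh : ∀ s ys R' O I y₀ yᵢ Q' →
         y₀ ∈ ys → yᵢ ∈ ys → y₀ ≢ yᵢ →
         y₀ ∉ (varsE Q' ++ varsE R' ++ varsV O ++ varsV I) →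
         yᵢ ∉ varsE Q' →
         sop s ys (hhTerm y₀ yᵢ Q' ⊞ R') O I ⟶H
         sop s (remove yᵢ ys)
             (substE yᵢ (hat (con true ⊞ Q')) (hhTerm y₀ yᵢ Q' ⊞ R'))
             (Vec.map (substE yᵢ (con true ⊞ Q')) O)
             (Vec.map (substE yᵢ (con true ⊞ Q')) I)

  _⟶*_ : ∀ {n m} → SOP n m → SOP n m → Set (c ⊔ˡ ℓ)
  _⟶*_ = Star (λ a b → a ≅ b ⊎ a ⟶E b ⊎ a ⟶H b)

  Monomial : Set c
  Monomial = Carrier × List ℕ

  monoExp : Monomial → Phase
  monoExp (a , vs) = foldr (λ y e → e ⊠ var y) (con a) vs

  monoVars : Monomial → List ℕ
  monoVars (_ , vs) = vs

  sumMonos : List Monomial → Phase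
  sumMonos []        = con 0#
  sumMonos (mo ∷ ms) = monoExp mo ⊞ sumMonos ms

  Aof : ∀ {n m} (t : SOP n m) → SOP (length (svars t)) m
  Aof t = sop (scalar t) (svars t) (con 0#) (out t) (idVec (svars t))

  Dof : ∀ {n m} (t : SOP n m) → Monomial → SOP (length (svars t)) (length (svars t))
  Dof t mo = sop 1# (svars t) (monoExp mo) (idVec (svars t)) (idVec (svars t))

  Bof : ∀ {n m} (t : SOP n m) → SOP n (length (svars t))
  Bof t = sop 1# (svars t) (con 0#) (idVec (svars t)) (inp t)

  chain : ∀ {n m} (t : SOP n m) → List Monomial → SOP n (length (svars t))
  chain t []        = Bof t
  chain t (mo ∷ ms) = Dof t mo ∘ˢ chain t ms

-- Composing A ∘ D₁ ∘ ⋯ ∘ D_ℓ ∘ B introduces, for every summation variable v of t and every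
-- composition, a shifted copy v' of v and a guard variable z with the phase term z (v' + v) / 2.
-- Up to an integer this term is an (HH) redex which substitutes v for v'; afterwards z occurs
-- nowhere and (Elim) removes it while doubling the scalar.  Contracting the k wires between A
-- and D₁ ∘ C leaves a composite A' ∘ C of the same shape, where A' has absorbed the phase of D₁,
-- and the factor 2^k cancels the normalisation 2^(-k) of that composition.  After ℓ + 1 such
-- layers only t is left.

module Submission where

open import Defs
open import Algebra.Bundles using (CommutativeRing)
open import Data.Nat using (ℕ; _<_)
open import Data.List using (List; length)
open import Data.List.Membership.Propositional using (_∈_)
open import Data.List.Relation.Unary.All using (All)

open import Data.Bool using (Bool; true; false; not; _xor_; _∧_; if_then_else_)
open import Data.Bool.Properties using (not-involutive)
open import Data.Nat using (zero; suc; _≤_; _⊔_; _≟_; _≡ᵇ_; s≤s) renaming (_+_ to _+ℕ_)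
open import Data.Nat.Properties
  using (≤-refl; ≤-trans; <-≤-trans; <⇒≱; n≤1+n; m≤m+n; m≤m⊔n; m≤n⊔m;
         +-suc; +-cancelˡ-≡; +-monoʳ-<; +-monoʳ-≤)
  renaming (+-assoc to +ℕ-assoc)
open import Data.List using ([]; _∷_; _++_; map)
open import Data.List.Properties
  using (map-++; map-id; map-id-local; map-∘; map-cong; ++-assoc; ++-identityʳ; ∷-injective; filter-all; filter-reject)
open import Data.List.Membership.Propositional using (_∉_)
open import Data.List.Membership.Propositional.Properties using (∈-++⁺ˡ; ∈-++⁺ʳ; ∈-++⁻; ∈-map⁻)
open import Data.List.Relation.Unary.Any using (here; there)
open import Data.List.Relation.Unary.All using ([]; _∷_)
import Data.List.Relation.Unary.All as All
open import Data.List.Relation.Unary.All.Properties using (¬Any⇒All¬)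
open import Data.List.Relation.Unary.Unique.Propositional using (Unique)
open import Data.List.Relation.Unary.AllPairs using ([]; _∷_)
open import Data.List.Relation.Unary.Unique.Propositional.Properties using (++⁺; map⁺; drop⁺; Unique[x∷xs]⇒x∉xs)
open import Data.List.Relation.Binary.Disjoint.Propositional using (Disjoint)
open import Data.List.Relation.Binary.Subset.Propositional using (_⊆_)
import Data.List.Relation.Binary.Subset.Propositional.Properties as ⊆
open import Data.List.Relation.Binary.Permutation.Propositional
  using (_↭_; ↭-prep; ↭-reflexive; ↭-trans; ↭⇒↭ₛ)
import Data.List.Relation.Binary.Permutation.Propositional.Properties as Perm
import Data.List.Relation.Binary.Permutation.Setoid.Properties as PermSetoid
open import Data.Vec as Vec using (Vec)
import Data.Vec.Properties as VecP
import Algebra.Properties.CommutativeSemigroup as CommSemigroupProperties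
open import Relation.Binary.Construct.Closure.ReflexiveTransitive using (ε; _◅_; _◅◅_)
open import Data.Integer using (ℤ; +_; -[1+_])
open import Data.Fin using (Fin)
open import Data.Product using (∃; _,_; proj₁; proj₂)
open import Data.Sum using (_⊎_; inj₁; inj₂)
open import Data.Empty using (⊥-elim)
open import Function using (_∘_; id; case_of_)
open import Relation.Nullary using (¬?; yes; no; does)
open import Relation.Nullary.Decidable using (dec-true; dec-false)
open import Relation.Binary.PropositionalEquality
  using (_≡_; _≢_; _≗_; refl; sym; trans; cong; cong₂; subst)
  renaming (setoid to ≡-setoid)

module _ {a} {A : Set a} where

  varsE-renameE : ∀ f (e : Exp A) → varsE (renameE f e) ≡ map f (varsE e)
  varsE-renameE f (con _)  = refl
  varsE-renameE f (var _)  = refl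
  varsE-renameE f (e ⊞ e') =
    trans (cong₂ _++_ (varsE-renameE f e) (varsE-renameE f e')) (sym (map-++ f (varsE e) (varsE e')))
  varsE-renameE f (e ⊠ e') =
    trans (cong₂ _++_ (varsE-renameE f e) (varsE-renameE f e')) (sym (map-++ f (varsE e) (varsE e')))

  varsV-renameE : ∀ f {k} (O : Vec (Exp A) k) → varsV (Vec.map (renameE f) O) ≡ map f (varsV O)
  varsV-renameE f Vec.[]      = refl
  varsV-renameE f (e Vec.∷ O) =
    trans (cong₂ _++_ (varsE-renameE f e) (varsV-renameE f O)) (sym (map-++ f (varsE e) (varsV O)))

  varsE-lookup⊆varsV : ∀ {k} (O : Vec (Exp A) k) i {x} → x ∈ varsE (Vec.lookup O i) → x ∈ varsV O
  varsE-lookup⊆varsV (e Vec.∷ O) Fin.zero    x∈ = ∈-++⁺ˡ x∈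
  varsE-lookup⊆varsV (e Vec.∷ O) (Fin.suc i) x∈ = ∈-++⁺ʳ (varsE e) (varsE-lookup⊆varsV O i x∈)

  renameE-∘ : ∀ f g (e : Exp A) → renameE f (renameE g e) ≡ renameE (f ∘ g) e
  renameE-∘ f g (con _)  = refl
  renameE-∘ f g (var _)  = refl
  renameE-∘ f g (e ⊞ e') = cong₂ _⊞_ (renameE-∘ f g e) (renameE-∘ f g e')
  renameE-∘ f g (e ⊠ e') = cong₂ _⊠_ (renameE-∘ f g e) (renameE-∘ f g e')

  renameE-cong-local : ∀ {f g} (e : Exp A) → (∀ {x} → x ∈ varsE e → f x ≡ g x) → renameE f e ≡ renameE g e
  renameE-cong-local (con _)  f≡g = refl
  renameE-cong-local (var _)  f≡g = cong var (f≡g (here refl))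
  renameE-cong-local (e ⊞ e') f≡g =
    cong₂ _⊞_ (renameE-cong-local e (f≡g ∘ ∈-++⁺ˡ)) (renameE-cong-local e' (f≡g ∘ ∈-++⁺ʳ (varsE e)))
  renameE-cong-local (e ⊠ e') f≡g =
    cong₂ _⊠_ (renameE-cong-local e (f≡g ∘ ∈-++⁺ˡ)) (renameE-cong-local e' (f≡g ∘ ∈-++⁺ʳ (varsE e)))

  renameE-id : (e : Exp A) → renameE id e ≡ e
  renameE-id (con _)  = refl
  renameE-id (var _)  = refl
  renameE-id (e ⊞ e') = cong₂ _⊞_ (renameE-id e) (renameE-id e')
  renameE-id (e ⊠ e') = cong₂ _⊠_ (renameE-id e) (renameE-id e')

  renameE-id-local : ∀ {f} (e : Exp A) → (∀ {x} → x ∈ varsE e → f x ≡ x) → renameE f e ≡ e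
  renameE-id-local e f≡id = trans (renameE-cong-local e f≡id) (renameE-id e)

  renameE-cong : ∀ {f g} → f ≗ g → (e : Exp A) → renameE f e ≡ renameE g e
  renameE-cong f≗g e = renameE-cong-local e (λ {x} _ → f≗g x)

  map-renameE-∘ : ∀ f g {k} (O : Vec (Exp A) k) →
                  Vec.map (renameE f) (Vec.map (renameE g) O) ≡ Vec.map (renameE (f ∘ g)) O
  map-renameE-∘ f g O = trans (sym (VecP.map-∘ (renameE f) (renameE g) O)) (VecP.map-cong (renameE-∘ f g) O)

  map-renameE-id : ∀ {k} (O : Vec (Exp A) k) → Vec.map (renameE id) O ≡ O
  map-renameE-id O = trans (VecP.map-cong renameE-id O) (VecP.map-id O)

_[_≔_] : (ℕ → Bool) → ℕ → Bool → ℕ → Bool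
(σ [ y ≔ b ]) x = if does (x ≟ y) then b else σ x

update-same : ∀ σ y b → (σ [ y ≔ b ]) y ≡ b
update-same σ y b = cong (λ c → if c then b else σ y) (dec-true (y ≟ y) refl)

update-other : ∀ σ {y} b {x} → x ≢ y → (σ [ y ≔ b ]) x ≡ σ x
update-other σ {y} b {x} x≢y = cong (λ c → if c then b else σ x) (dec-false (x ≟ y) x≢y)

evalB-renameE : ∀ σ f e → evalB σ (renameE f e) ≡ evalB (σ ∘ f) e
evalB-renameE σ f (con _)  = refl
evalB-renameE σ f (var _)  = refl
evalB-renameE σ f (e ⊞ e') = cong₂ _xor_ (evalB-renameE σ f e) (evalB-renameE σ f e')
evalB-renameE σ f (e ⊠ e') = cong₂ _∧_ (evalB-renameE σ f e) (evalB-renameE σ f e')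

evalB-cong : ∀ {σ σ'} → σ ≗ σ' → ∀ e → evalB σ e ≡ evalB σ' e
evalB-cong σ≗σ' (con _)  = refl
evalB-cong σ≗σ' (var y)  = σ≗σ' y
evalB-cong σ≗σ' (e ⊞ e') = cong₂ _xor_ (evalB-cong σ≗σ' e) (evalB-cong σ≗σ' e')
evalB-cong σ≗σ' (e ⊠ e') = cong₂ _∧_ (evalB-cong σ≗σ' e) (evalB-cong σ≗σ' e')

evalB-substE : ∀ σ y Q e → evalB σ (substE y Q e) ≡ evalB (σ [ y ≔ evalB σ Q ]) e
evalB-substE σ y Q (con _)  = refl
-- does (x ≟ y) computes to x ≡ᵇ y, which is what the goal mentions.
evalB-substE σ y Q (var x) with x ≡ᵇ y
... | true  = refl
... | false = refl
evalB-substE σ y Q (e ⊞ e') = cong₂ _xor_ (evalB-substE σ y Q e) (evalB-substE σ y Q e')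
evalB-substE σ y Q (e ⊠ e') = cong₂ _∧_ (evalB-substE σ y Q e) (evalB-substE σ y Q e')

redirect : ℕ → ℕ → ℕ → ℕ
redirect y a x = if does (x ≟ y) then a else x

redirect-same : ∀ y a → redirect y a y ≡ a
redirect-same y a = cong (λ c → if c then a else y) (dec-true (y ≟ y) refl)

redirect-other : ∀ {y} a {x} → x ≢ y → redirect y a x ≡ x
redirect-other {y} a {x} x≢y = cong (λ c → if c then a else x) (dec-false (x ≟ y) x≢y)

∘-redirect : ∀ σ y a → σ ∘ redirect y a ≗ σ [ y ≔ σ a ]
∘-redirect σ y a x with x ≡ᵇ y
... | true  = refl
... | false = refl

∘-redirect-not-not : ∀ σ y a → σ ∘ redirect y a ≗ σ [ y ≔ not (not (σ a)) ]
∘-redirect-not-not σ y a x =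
  trans (∘-redirect σ y a x) (cong (λ b → (σ [ y ≔ b ]) x) (sym (not-involutive (σ a))))

renamed-≈V-substituted : ∀ {y a k} (U : Vec F2 k) →
  Vec.map (renameE (redirect y a)) U ≈V Vec.map (substE y (con true ⊞ (con true ⊞ var a))) U
renamed-≈V-substituted {y} {a} U i σ =
  trans (cong (evalB σ) (VecP.lookup-map i (renameE (redirect y a)) U))
  (trans (evalB-renameE σ (redirect y a) (Vec.lookup U i))
  (trans (evalB-cong (∘-redirect-not-not σ y a) (Vec.lookup U i))
  (trans (sym (evalB-substE σ y (con true ⊞ (con true ⊞ var a)) (Vec.lookup U i)))
         (sym (cong (evalB σ) (VecP.lookup-map i (substE y (con true ⊞ (con true ⊞ var a))) U))))))

∉-map-redirect : ∀ {y a x} xs → x ≢ a → x ∉ xs → x ∉ map (redirect y a) xs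
∉-map-redirect {y} {a} {x} xs x≢a x∉xs x∈ with ∈-map⁻ (redirect y a) x∈
... | w , w∈xs , x≡rw with w ≟ y
...   | yes refl = x≢a (trans x≡rw (redirect-same y a))
...   | no w≢y   = x∉xs (subst (_∈ xs) (sym (trans x≡rw (redirect-other a w≢y))) w∈xs)

remove-∉ : ∀ {y} xs → y ∉ xs → remove y xs ≡ xs
remove-∉ {y} xs y∉xs =
  filter-all (λ x → ¬? (x ≟ y)) (All.map (λ y≢x → y≢x ∘ sym) (¬Any⇒All¬ xs y∉xs))

remove-head : ∀ {y} xs → y ∉ xs → remove y (y ∷ xs) ≡ xs
remove-head {y} xs y∉xs = trans (filter-reject (λ x → ¬? (x ≟ y)) (λ y≢y → y≢y refl)) (remove-∉ xs y∉xs)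

++-⊆ : ∀ {a} {A : Set a} {xs ys zs : List A} → xs ⊆ zs → ys ⊆ zs → xs ++ ys ⊆ zs
++-⊆ {xs = xs} xs⊆zs ys⊆zs x∈ with ∈-++⁻ xs x∈
... | inj₁ x∈xs = xs⊆zs x∈xs
... | inj₂ x∈ys = ys⊆zs x∈ys

Unique-++ʳ : ∀ (xs : List ℕ) {ys} → Unique (xs ++ ys) → Unique ys
Unique-++ʳ []       u       = u
Unique-++ʳ (x ∷ xs) (_ ∷ u) = Unique-++ʳ xs u

Unique-++-disjoint : ∀ (xs : List ℕ) {ys} → Unique (xs ++ ys) → Disjoint xs ys
Unique-++-disjoint (x ∷ xs) u (here refl , x∈ys) = Unique[x∷xs]⇒x∉xs u (∈-++⁺ʳ xs x∈ys)
Unique-++-disjoint (x ∷ xs) (_ ∷ u) (there v∈xs , v∈ys) = Unique-++-disjoint xs u (v∈xs , v∈ys)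

Unique-resp-↭ : ∀ {xs ys : List ℕ} → xs ↭ ys → Unique xs → Unique ys
Unique-resp-↭ p = PermSetoid.Unique-resp-↭ (≡-setoid ℕ) (↭⇒↭ₛ p)

regroup : ∀ {a} {A : Set a} (ws xs ys zs : List A) → ws ++ (xs ++ ys) ++ zs ↭ xs ++ zs ++ ws ++ ys
regroup ws xs ys zs =
  ↭-trans (↭-reflexive (cong (ws ++_) (++-assoc xs ys zs)))
  (↭-trans (Perm.shifts ws xs)
           (Perm.++⁺ˡ xs (↭-trans (↭-reflexive (sym (++-assoc ws ys zs))) (Perm.++-comm (ws ++ ys) zs))))

separated : ∀ {xs ys : List ℕ} b →
            (∀ {x} → x ∈ xs → x < b) → (∀ {y} → y ∈ ys → b ≤ y) → Disjoint xs ys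
separated b xs<b b≤ys (v∈xs , v∈ys) = <⇒≱ (xs<b v∈xs) (b≤ys v∈ys)

≤-maxL : ∀ {x} xs → x ∈ xs → x ≤ maxL xs
≤-maxL (y ∷ xs) (here refl) = m≤m⊔n y (maxL xs)
≤-maxL (y ∷ xs) (there x∈) = ≤-trans (≤-maxL xs x∈) (m≤n⊔m y (maxL xs))

map-+-map-+ : ∀ M N xs → map (M +ℕ_) (map (N +ℕ_) xs) ≡ map ((M +ℕ N) +ℕ_) xs
map-+-map-+ M N xs = trans (sym (map-∘ xs)) (map-cong (λ x → sym (+ℕ-assoc M N x)) xs)

∉-map-+ : ∀ M vs {x} → x < M → x ∉ map (M +ℕ_) vs
∉-map-+ M vs x<M x∈ with ∈-map⁻ (M +ℕ_) x∈
... | w , _ , refl = <⇒≱ x<M (m≤m+n M w)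

-- A wire from old to new carries the phase guard · (old + new) / 2 (wireTerm below); summing over
-- the guard identifies old with new.

record Wire : Set where
  constructor wire
  field
    guard old new : ℕ
open Wire

olds guards news : List Wire → List ℕ
olds   = map old
guards = map guard
news   = map new

rewire : List Wire → ℕ → ℕ
rewire []       = id
rewire (w ∷ ws) = rewire ws ∘ redirect (old w) (new w)

rewire-∉olds : ∀ ws {x} → x ∉ olds ws → rewire ws x ≡ x
rewire-∉olds []       x∉ = refl
rewire-∉olds (w ∷ ws) x∉ =
  trans (cong (rewire ws) (redirect-other (new w) (x∉ ∘ here))) (rewire-∉olds ws (x∉ ∘ there))

wiresFrom : (ℕ → ℕ) → ℕ → List ℕ → List Wire
wiresFrom f z []       = []
wiresFrom f z (v ∷ vs) = wire z (f v) v ∷ wiresFrom f (suc z) vs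

module _ (f : ℕ → ℕ) where

  olds-wiresFrom : ∀ z vs → olds (wiresFrom f z vs) ≡ map f vs
  olds-wiresFrom z []       = refl
  olds-wiresFrom z (v ∷ vs) = cong (f v ∷_) (olds-wiresFrom (suc z) vs)

  news-wiresFrom : ∀ z vs → news (wiresFrom f z vs) ≡ vs
  news-wiresFrom z []       = refl
  news-wiresFrom z (v ∷ vs) = cong (v ∷_) (news-wiresFrom (suc z) vs)

  length-wiresFrom : ∀ z vs → length (wiresFrom f z vs) ≡ length vs
  length-wiresFrom z []       = refl
  length-wiresFrom z (v ∷ vs) = cong suc (length-wiresFrom (suc z) vs)

rewire-shifted : ∀ M z {vs v} → (∀ {w} → w ∈ vs → w < M) → v ∈ vs →
                 rewire (wiresFrom (M +ℕ_) z vs) (M +ℕ v) ≡ v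
rewire-shifted M z {w ∷ vs} {v} vs<M v∈ with v ≟ w
... | yes refl = trans (cong (rewire (wiresFrom (M +ℕ_) (suc z) vs)) (redirect-same (M +ℕ v) v))
                   (rewire-∉olds (wiresFrom (M +ℕ_) (suc z) vs)
                     (subst (v ∉_) (sym (olds-wiresFrom (M +ℕ_) (suc z) vs)) (∉-map-+ M vs (vs<M (here refl)))))
... | no v≢w = trans (cong (rewire (wiresFrom (M +ℕ_) (suc z) vs)) (redirect-other w (v≢w ∘ +-cancelˡ-≡ M _ _)))
                 (rewire-shifted M (suc z) (vs<M ∘ there) (v∈tail v∈))
  where
  v∈tail : v ∈ w ∷ vs → v ∈ vs
  v∈tail (here v≡w) = ⊥-elim (v≢w v≡w)
  v∈tail (there v∈) = v∈

module Reduction {c ℓ} (R : CommutativeRing c ℓ) (half : CommutativeRing.Carrier R) where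
  open CommutativeRing R renaming (refl to ≈-refl; sym to ≈-sym; trans to ≈-trans)
  open SOPTheory R half
  open import Relation.Binary.Reasoning.Setoid setoid
  module + = CommSemigroupProperties +-commutativeSemigroup
  module * = CommSemigroupProperties *-commutativeSemigroup

  bit : Bool → Carrier
  bit b = if b then 1# else 0#

  bit-∧ : ∀ p q → bit p * bit q ≈ bit (p ∧ q)
  bit-∧ false q = zeroˡ (bit q)
  bit-∧ true  q = *-identityˡ (bit q)

  bit-xor : ∀ p q → (bit p + bit q) + - (1# + 1#) * (bit p * bit q) ≈ bit (p xor q)
  bit-xor false q     =
    ≈-trans (+-cong (+-identityˡ (bit q)) (≈-trans (*-congˡ (zeroˡ (bit q))) (zeroʳ _))) (+-identityʳ (bit q))
  bit-xor true  false =
    ≈-trans (+-cong (+-identityʳ 1#) (≈-trans (*-congˡ (zeroʳ 1#)) (zeroʳ _))) (+-identityʳ 1#)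
  bit-xor true  true  =
    ≈-trans (+-congˡ (≈-trans (*-congˡ (*-identityʳ 1#)) (*-identityʳ _))) (-‿inverseʳ (1# + 1#))

  bit-complement : ∀ b → bit b + bit (not b) ≈ 1#
  bit-complement false = +-identityˡ 1#
  bit-complement true  = +-identityʳ 1#

  evalR-hat : ∀ σ Q → evalR σ (hat Q) ≈ bit (evalB σ Q)
  evalR-hat σ (con true)  = ≈-refl
  evalR-hat σ (con false) = ≈-refl
  evalR-hat σ (var y)     = ≈-refl
  evalR-hat σ (Q ⊞ Q') =
    ≈-trans (+-cong (+-cong (evalR-hat σ Q) (evalR-hat σ Q')) (*-congˡ (*-cong (evalR-hat σ Q) (evalR-hat σ Q'))))
            (bit-xor (evalB σ Q) (evalB σ Q'))
  evalR-hat σ (Q ⊠ Q') = ≈-trans (*-cong (evalR-hat σ Q) (evalR-hat σ Q')) (bit-∧ (evalB σ Q) (evalB σ Q'))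

  evalR-renameE : ∀ σ f e → evalR σ (renameE f e) ≡ evalR (σ ∘ f) e
  evalR-renameE σ f (con _)  = refl
  evalR-renameE σ f (var _)  = refl
  evalR-renameE σ f (e ⊞ e') = cong₂ _+_ (evalR-renameE σ f e) (evalR-renameE σ f e')
  evalR-renameE σ f (e ⊠ e') = cong₂ _*_ (evalR-renameE σ f e) (evalR-renameE σ f e')

  evalR-cong : ∀ {σ σ'} → σ ≗ σ' → ∀ e → evalR σ e ≡ evalR σ' e
  evalR-cong σ≗σ' (con _)  = refl
  evalR-cong σ≗σ' (var y)  = cong bit (σ≗σ' y)
  evalR-cong σ≗σ' (e ⊞ e') = cong₂ _+_ (evalR-cong σ≗σ' e) (evalR-cong σ≗σ' e')
  evalR-cong σ≗σ' (e ⊠ e') = cong₂ _*_ (evalR-cong σ≗σ' e) (evalR-cong σ≗σ' e')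

  evalR-substE-hat : ∀ σ y Q e → evalR σ (substE y (hat Q) e) ≈ evalR (σ [ y ≔ evalB σ Q ]) e
  evalR-substE-hat σ y Q (con _)  = ≈-refl
  evalR-substE-hat σ y Q (var x) with x ≡ᵇ y
  ... | true  = evalR-hat σ Q
  ... | false = ≈-refl
  evalR-substE-hat σ y Q (e ⊞ e') = +-cong (evalR-substE-hat σ y Q e) (evalR-substE-hat σ y Q e')
  evalR-substE-hat σ y Q (e ⊠ e') = *-cong (evalR-substE-hat σ y Q e) (evalR-substE-hat σ y Q e')

  infix 4 _≈ℤ_ _≐_

  -- P ≈ₚ Q unfolds to ∀ σ → evalR σ P ≈ℤ evalR σ Q.
  _≈ℤ_ : Carrier → Carrier → Set ℓ
  x ≈ℤ y = ∃ λ (w : ℤ) → x ≈ y + fromℤ w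

  ≈⇒≈ℤ : ∀ {x y} → x ≈ y → x ≈ℤ y
  ≈⇒≈ℤ x≈y = + 0 , ≈-trans x≈y (≈-sym (+-identityʳ _))

  ≈ℤ-respˡ : ∀ {x x' y} → x' ≈ x → x ≈ℤ y → x' ≈ℤ y
  ≈ℤ-respˡ x'≈x (w , x≈) = w , ≈-trans x'≈x x≈

  ≈ℤ-respʳ : ∀ {x y y'} → y ≈ y' → x ≈ℤ y → x ≈ℤ y'
  ≈ℤ-respʳ y≈y' (w , x≈) = w , ≈-trans x≈ (+-congʳ y≈y')

  ≈ℤ-+ʳ : ∀ {x y} r → x ≈ℤ y → x + r ≈ℤ y + r
  ≈ℤ-+ʳ {y = y} r (w , x≈) = w , ≈-trans (+-congʳ x≈) (+.xy∙z≈xz∙y y (fromℤ w) r)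

  ≈ℤ-bit+ : ∀ b x → x ≈ℤ bit b + x
  ≈ℤ-bit+ false x = + 0 , ≈-sym (≈-trans (+-identityʳ _) (+-identityˡ x))
  ≈ℤ-bit+ true  x = -[1+ 0 ] , (begin
    x                      ≈⟨ +-identityʳ x ⟨
    x + 0#                 ≈⟨ +-congˡ (-‿inverseʳ 1#) ⟨
    x + (1# + - 1#)        ≈⟨ +-assoc x 1# (- 1#) ⟨
    (x + 1#) + - 1#        ≈⟨ +-cong (+-comm x 1#) (-‿cong (≈-sym (+-identityʳ 1#))) ⟩
    (1# + x) + - (1# + 0#) ∎)

  _≐_ : Phase → Phase → Set ℓ
  P ≐ Q = ∀ σ → evalR σ P ≈ evalR σ Q

  ≐⇒≈ₚ : ∀ {P Q} → P ≐ Q → P ≈ₚ Q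
  ≐⇒≈ₚ P≐Q σ = ≈⇒≈ℤ (P≐Q σ)

  ≈ₚ-respʳ : ∀ {P Q Q'} → Q ≐ Q' → P ≈ₚ Q → P ≈ₚ Q'
  ≈ₚ-respʳ Q≐Q' P≈Q σ = ≈ℤ-respʳ (Q≐Q' σ) (P≈Q σ)

  identify : ∀ {n m s s' K K' Ph Ph'} {O O' : Vec F2 m} {I I' : Vec F2 n} →
             s' ≈ s → K ↭ K' → Ph' ≈ₚ Ph → O' ≈V O → I' ≈V I →
             sop s K Ph O I ⟶* sop s' K' Ph' O' I'
  identify {K = K} {K'} {Ph} {Ph'} {O} {O'} {I} {I'} s'≈s K↭K' Ph'≈Ph O'≈O I'≈I = inj₁ identity ◅ ε
    where
    identity : sop _ K Ph O I ≅ sop _ _ _ _ _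
    identity = record
      { ρ       = id
      ; ρ-inj   = id
      ; scalar≈ = s'≈s
      ; svars↭  = subst (_↭ K') (sym (map-id K)) K↭K'
      ; phase≈  = subst (Ph' ≈ₚ_) (sym (renameE-id Ph)) Ph'≈Ph
      ; out≈    = subst (O' ≈V_) (sym (map-renameE-id O)) O'≈O
      ; inp≈    = subst (I' ≈V_) (sym (map-renameE-id I)) I'≈I
      }

  ≡⇒≈V : ∀ {k} {u v : Vec F2 k} → u ≡ v → u ≈V v
  ≡⇒≈V refl i σ = refl

  ≈V-map-renameE-id-local : ∀ {f k} (O : Vec F2 k) → (∀ {x} → x ∈ varsV O → f x ≡ x) →
                            O ≈V Vec.map (renameE f) O
  ≈V-map-renameE-id-local {f} O f≡id i σ =
    cong (evalB σ) (sym (trans (VecP.lookup-map i (renameE f) O)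
                               (renameE-id-local (Vec.lookup O i) (f≡id ∘ varsE-lookup⊆varsV O i))))

  occurring : ∀ {n m} → Phase → Vec F2 m → Vec F2 n → List ℕ
  occurring P O I = varsE P ++ varsV O ++ varsV I

  occurring-renameE : ∀ {n m} f P (O : Vec F2 m) (I : Vec F2 n) →
    occurring (renameE f P) (Vec.map (renameE f) O) (Vec.map (renameE f) I) ≡ map f (occurring P O I)
  occurring-renameE f P O I =
    trans (cong₂ _++_ (varsE-renameE f P) (cong₂ _++_ (varsV-renameE f O) (varsV-renameE f I)))
          (sym (trans (map-++ f (varsE P) _) (cong (map f (varsE P) ++_) (map-++ f (varsV O) (varsV I)))))

  wireTerm : Wire → Phase
  wireTerm (wire z y a) = con half ⊠ ((var y ⊞ var a) ⊠ var z)

  wiresTerm : List Wire → Phase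
  wiresTerm []       = con 0#
  wiresTerm (w ∷ ws) = wireTerm w ⊞ wiresTerm ws

  varsE-wiresTerm : ∀ ws → varsE (wiresTerm ws) ⊆ olds ws ++ guards ws ++ news ws
  varsE-wiresTerm (wire z y a ∷ ws) (here x≡y)                = here x≡y
  varsE-wiresTerm (wire z y a ∷ ws) (there (here x≡a))        =
    there (∈-++⁺ʳ (olds ws) (there (∈-++⁺ʳ (guards ws) (here x≡a))))
  varsE-wiresTerm (wire z y a ∷ ws) (there (there (here x≡z))) = there (∈-++⁺ʳ (olds ws) (here x≡z))
  varsE-wiresTerm (wire z y a ∷ ws) (there (there (there x∈))) =
    there (⊆.++⁺ʳ (olds ws) (⊆.++⁺ (⊆.xs⊆x∷xs (guards ws) z) (⊆.xs⊆x∷xs (news ws) a))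
                  (varsE-wiresTerm ws x∈))

  zTerms-wiresFrom : ∀ f z vs → zTerms z (Vec.map (renameE f) (idVec vs)) (idVec vs) ≡ wiresTerm (wiresFrom f z vs)
  zTerms-wiresFrom f z []       = refl
  zTerms-wiresFrom f z (v ∷ vs) = cong (wireTerm (wire z (f v) v) ⊞_) (zTerms-wiresFrom f (suc z) vs)

  renameE-wiresFrom : ∀ {g f f' z z'} vs →
    map (g ∘ f) vs ≡ map f' vs → map g vs ≡ vs → map g (zList z (length vs)) ≡ zList z' (length vs) →
    renameE g (wiresTerm (wiresFrom f z vs)) ≡ wiresTerm (wiresFrom f' z' vs)
  renameE-wiresFrom []       _ _ _ = refl
  renameE-wiresFrom {g} {f} {f'} {z} {z'} (v ∷ vs) gf≡f' g≡id gz≡z' =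
    cong₂ _⊞_ (cong wireTerm wire≡)
              (renameE-wiresFrom vs (proj₂ (∷-injective gf≡f')) (proj₂ (∷-injective g≡id))
                                    (proj₂ (∷-injective gz≡z')))
    where
    wire≡ : wire (g z) (g (f v)) (g v) ≡ wire z' (f' v) v
    wire≡ = trans (cong (λ x → wire x (g (f v)) (g v)) (proj₁ (∷-injective gz≡z')))
                  (cong₂ (wire z') (proj₁ (∷-injective gf≡f')) (proj₁ (∷-injective g≡id)))

  renameE-zTerms : ∀ {g f f' z z'} vs {O} → O ≡ idVec vs →
    map (g ∘ f) vs ≡ map f' vs → map g vs ≡ vs → map g (zList z (length vs)) ≡ zList z' (length vs) →
    renameE g (zTerms z (Vec.map (renameE f) O) (idVec vs)) ≡ zTerms z' (Vec.map (renameE f') O) (idVec vs)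
  renameE-zTerms {g} {f} {f'} {z} {z'} vs refl gf≡f' g≡id gz≡z' =
    trans (cong (renameE g) (zTerms-wiresFrom f z vs))
          (trans (renameE-wiresFrom vs gf≡f' g≡id gz≡z') (sym (zTerms-wiresFrom f' z' vs)))

  zList-≥ : ∀ {x} z k → x ∈ zList z k → z ≤ x
  zList-≥ z (suc k) (here refl) = ≤-refl
  zList-≥ z (suc k) (there x∈)  = ≤-trans (n≤1+n z) (zList-≥ (suc z) k x∈)

  zList-Unique : ∀ z k → Unique (zList z k)
  zList-Unique z zero    = []
  zList-Unique z (suc k) =
    ¬Any⇒All¬ (zList (suc z) k) (λ z∈ → <⇒≱ ≤-refl (zList-≥ (suc z) k z∈)) ∷ zList-Unique (suc z) k

  map-+-zList : ∀ M z k → map (M +ℕ_) (zList z k) ≡ zList (M +ℕ z) k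
  map-+-zList M z zero    = refl
  map-+-zList M z (suc k) =
    cong ((M +ℕ z) ∷_) (trans (map-+-zList M (suc z) k) (cong (λ z' → zList z' k) (+-suc M z)))

  Unique-shifted : ∀ {xs ys : List ℕ} {M z₀} k → Unique xs → Unique ys →
                   (∀ {x} → x ∈ xs → x < M) → M ≤ z₀ → (∀ {y} → y ∈ ys → M +ℕ y < z₀) →
                   Unique (xs ++ map (M +ℕ_) ys ++ zList z₀ k)
  Unique-shifted {xs} {ys} {M} {z₀} k xs! ys! xs<M M≤z₀ M+ys<z₀ =
    ++⁺ xs! (++⁺ (map⁺ (+-cancelˡ-≡ M _ _) ys!) (zList-Unique z₀ k) (separated z₀ shifted<z₀ (zList-≥ z₀ k)))
            (separated M xs<M M≤rest)
    where
    shifted<z₀ : ∀ {x} → x ∈ map (M +ℕ_) ys → x < z₀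
    shifted<z₀ x∈ with ∈-map⁻ (M +ℕ_) x∈
    ... | y , y∈ys , refl = M+ys<z₀ y∈ys
    M≤rest : ∀ {x} → x ∈ map (M +ℕ_) ys ++ zList z₀ k → M ≤ x
    M≤rest x∈ with ∈-++⁻ (map (M +ℕ_) ys) x∈
    ... | inj₂ x∈zs = ≤-trans M≤z₀ (zList-≥ z₀ k x∈zs)
    ... | inj₁ x∈ with ∈-map⁻ (M +ℕ_) x∈
    ...   | y , _ , refl = m≤m+n M y

  guards-wiresFrom : ∀ f z vs → guards (wiresFrom f z vs) ≡ zList z (length vs)
  guards-wiresFrom f z []       = refl
  guards-wiresFrom f z (v ∷ vs) = cong (z ∷_) (guards-wiresFrom f (suc z) vs)

  -- f ∘ˢ g is wired (scalar f * scalar g * powR half m) N (N + N) f g for N = offset f g;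
  -- contracting the outer layer of a composite leaves this shape with other offsets and scalar.
  wired : ∀ {n m l} → Carrier → ℕ → ℕ → SOP m l → SOP n m → SOP n l
  wired {m = m} s M z₀ f g =
    sop s (svars f ++ map (M +ℕ_) (svars g) ++ zList z₀ m)
        ((renameE (M +ℕ_) (phase g) ⊞ phase f) ⊞ zTerms z₀ (Vec.map (renameE (M +ℕ_)) (out g)) (inp f))
        (out f) (Vec.map (renameE (M +ℕ_)) (inp g))

  offset : ∀ {n m l} → SOP m l → SOP n m → ℕ
  offset f g = suc (maxSOP f ⊔ maxSOP g)

  svars-<-offsetˡ : ∀ {n m l} (f : SOP m l) (g : SOP n m) {x} → x ∈ svars f → x < offset f g
  svars-<-offsetˡ f g x∈ = s≤s (≤-trans (≤-maxL (svars f ++ allVars f) (∈-++⁺ˡ x∈)) (m≤m⊔n _ _))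

  svars-<-offsetʳ : ∀ {n m l} (f : SOP m l) (g : SOP n m) {x} → x ∈ svars g → x < offset f g
  svars-<-offsetʳ f g x∈ = s≤s (≤-trans (≤-maxL (svars g ++ allVars g) (∈-++⁺ˡ x∈)) (m≤n⊔m _ _))

  varsE-hat : ∀ Q → varsE (hat Q) ⊆ varsE Q
  varsE-hat (con true)  ()
  varsE-hat (con false) ()
  varsE-hat (var y)     y∈ = y∈
  varsE-hat (Q ⊞ Q') = ++-⊆ both both
    where both = ⊆.++⁺ (varsE-hat Q) (varsE-hat Q')
  varsE-hat (Q ⊠ Q') = ⊆.++⁺ (varsE-hat Q) (varsE-hat Q')

  varsE-zTerms : ∀ z {k} (os is : Vec F2 k) {x} → x ∈ varsE (zTerms z os is) →
                 x ∈ varsV os ⊎ x ∈ varsV is ⊎ x ∈ zList z k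
  varsE-zTerms z Vec.[] Vec.[] ()
  varsE-zTerms z (o Vec.∷ os) (i Vec.∷ is) x∈ with ∈-++⁻ ((varsE (hat o) ++ varsE (hat i)) ++ z ∷ []) x∈
  ... | inj₁ x∈wire = wire-case (∈-++⁻ (varsE (hat o) ++ varsE (hat i)) x∈wire)
    where
    wire-case : _ ⊎ _ → _
    wire-case (inj₂ (here refl)) = inj₂ (inj₂ (here refl))
    wire-case (inj₁ x∈oi) with ∈-++⁻ (varsE (hat o)) x∈oi
    ... | inj₁ x∈o = inj₁ (∈-++⁺ˡ (varsE-hat o x∈o))
    ... | inj₂ x∈i = inj₂ (inj₁ (∈-++⁺ˡ (varsE-hat i x∈i)))
  ... | inj₂ x∈rest with varsE-zTerms (suc z) os is x∈rest
  ...   | inj₁ x∈os          = inj₁ (∈-++⁺ʳ (varsE o) x∈os)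
  ...   | inj₂ (inj₁ x∈is)   = inj₂ (inj₁ (∈-++⁺ʳ (varsE i) x∈is))
  ...   | inj₂ (inj₂ x∈zs)   = inj₂ (inj₂ (there x∈zs))

  WF-wired : ∀ {n m l s M z₀} (f : SOP m l) (g : SOP n m) → WF f → WF g →
             (∀ {x} → x ∈ svars f → x < M) → M ≤ z₀ → (∀ {y} → y ∈ svars g → M +ℕ y < z₀) →
             WF (wired s M z₀ f g)
  WF-wired {m = m} {M = M} {z₀} f g (f! , f-closed) (g! , g-closed) f<M M≤z₀ g<z₀ =
    Unique-shifted m f! g! f<M M≤z₀ g<z₀ , λ _ → ++-⊆ (++-⊆ (++-⊆ g-phase f-phase) wires) (++-⊆ f-out g-inp)
    where
    K = svars f ++ map (M +ℕ_) (svars g) ++ zList z₀ m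
    inF : svars f ⊆ K
    inF = ∈-++⁺ˡ
    shifted : ∀ {xs} → xs ⊆ svars g → map (M +ℕ_) xs ⊆ K
    shifted xs⊆ = ∈-++⁺ʳ (svars f) ∘ ∈-++⁺ˡ ∘ ⊆.map⁺ (M +ℕ_) xs⊆
    g-phase : varsE (renameE (M +ℕ_) (phase g)) ⊆ K
    g-phase = subst (_⊆ K) (sym (varsE-renameE (M +ℕ_) (phase g))) (shifted (g-closed _ ∘ ∈-++⁺ˡ))
    f-phase : varsE (phase f) ⊆ K
    f-phase = inF ∘ f-closed _ ∘ ∈-++⁺ˡ
    f-out : varsV (out f) ⊆ K
    f-out = inF ∘ f-closed _ ∘ ∈-++⁺ʳ (varsE (phase f)) ∘ ∈-++⁺ˡ
    f-inp : varsV (inp f) ⊆ K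
    f-inp = inF ∘ f-closed _ ∘ ∈-++⁺ʳ (varsE (phase f)) ∘ ∈-++⁺ʳ (varsV (out f))
    g-out : varsV (Vec.map (renameE (M +ℕ_)) (out g)) ⊆ K
    g-out = subst (_⊆ K) (sym (varsV-renameE (M +ℕ_) (out g)))
                  (shifted (g-closed _ ∘ ∈-++⁺ʳ (varsE (phase g)) ∘ ∈-++⁺ˡ))
    g-inp : varsV (Vec.map (renameE (M +ℕ_)) (inp g)) ⊆ K
    g-inp = subst (_⊆ K) (sym (varsV-renameE (M +ℕ_) (inp g)))
                  (shifted (g-closed _ ∘ ∈-++⁺ʳ (varsE (phase g)) ∘ ∈-++⁺ʳ (varsV (out g))))
    wires : varsE (zTerms z₀ (Vec.map (renameE (M +ℕ_)) (out g)) (inp f)) ⊆ K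
    wires x∈ with varsE-zTerms z₀ (Vec.map (renameE (M +ℕ_)) (out g)) (inp f) x∈
    ... | inj₁ x∈os        = g-out x∈os
    ... | inj₂ (inj₁ x∈is) = f-inp x∈is
    ... | inj₂ (inj₂ x∈zs) = ∈-++⁺ʳ (svars f) (∈-++⁺ʳ (map (M +ℕ_) (svars g)) x∈zs)

  WF-∘ˢ : ∀ {n m l} (f : SOP m l) (g : SOP n m) → WF f → WF g → WF (f ∘ˢ g)
  WF-∘ˢ {m = m} f g f-wf g-wf =
    WF-wired {s = scalar f * scalar g * powR half m} f g f-wf g-wf
             (svars-<-offsetˡ f g) (m≤m+n N N) (+-monoʳ-< N ∘ svars-<-offsetʳ f g)
    where N = offset f g

  varsV-idVec : ∀ vs → varsV (idVec vs) ≡ vs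
  varsV-idVec []       = refl
  varsV-idVec (v ∷ vs) = cong (v ∷_) (varsV-idVec vs)

  varsE-monoExp : ∀ mo → varsE (monoExp mo) ⊆ monoVars mo
  varsE-monoExp (a , vs) = factors vs
    where
    factors : ∀ vs → varsE (monoExp (a , vs)) ⊆ vs
    factors (v ∷ vs) x∈ with ∈-++⁻ (varsE (monoExp (a , vs))) x∈
    ... | inj₁ x∈vs       = there (factors vs x∈vs)
    ... | inj₂ (here x≡v) = here x≡v

  doubled : ℕ → Carrier → Carrier
  doubled zero    s = s
  doubled (suc j) s = doubled j ((1# + 1#) * s)

  doubled-cong : ∀ j {a b} → a ≈ b → doubled j a ≈ doubled j b
  doubled-cong zero    a≈b = a≈b
  doubled-cong (suc j) a≈b = doubled-cong j (*-congˡ a≈b)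

  -- Contracting wires

  module _ (half-inverse : half * (1# + 1#) ≈ 1#) where

    halve-+2 : ∀ y → half * ((y + 1#) + 1#) ≈ half * y + 1#
    halve-+2 y = begin
      half * ((y + 1#) + 1#)      ≈⟨ *-congˡ (+-assoc y 1# 1#) ⟩
      half * (y + (1# + 1#))      ≈⟨ distribˡ half y (1# + 1#) ⟩
      half * y + half * (1# + 1#) ≈⟨ +-congˡ half-inverse ⟩
      half * y + 1#               ∎

    hhValue-≈ℤ-wireValue : ∀ bz y ba →
                           (half * bit bz) * ((y + bit (not ba)) + 1#) ≈ℤ half * ((y + bit ba) * bit bz)
    hhValue-≈ℤ-wireValue false y ba = ≈⇒≈ℤ (begin
      (half * 0#) * ((y + bit (not ba)) + 1#) ≈⟨ *-congʳ (zeroʳ half) ⟩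
      0# * ((y + bit (not ba)) + 1#)          ≈⟨ zeroˡ _ ⟩
      0#                                      ≈⟨ zeroʳ half ⟨
      half * 0#                               ≈⟨ *-congˡ (zeroʳ (y + bit ba)) ⟨
      half * ((y + bit ba) * 0#)              ∎)
    hhValue-≈ℤ-wireValue true y true = ≈⇒≈ℤ (begin
      (half * 1#) * ((y + 0#) + 1#) ≈⟨ *-cong (*-identityʳ half) (+-congʳ (+-identityʳ y)) ⟩
      half * (y + 1#)               ≈⟨ *-congˡ (*-identityʳ (y + 1#)) ⟨
      half * ((y + 1#) * 1#)        ∎)
    hhValue-≈ℤ-wireValue true y false = + 1 , (begin
      (half * 1#) * ((y + 1#) + 1#) ≈⟨ *-congʳ (*-identityʳ half) ⟩
      half * ((y + 1#) + 1#)        ≈⟨ halve-+2 y ⟩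
      half * y + 1#
        ≈⟨ +-cong (*-congˡ (≈-trans (*-identityʳ _) (+-identityʳ y))) (+-identityʳ 1#) ⟨
      half * ((y + 0#) * 1#) + (1# + 0#) ∎)

    hhValue-solved : ∀ bz ba → (half * bit bz) * ((bit ba + bit (not ba)) + 1#) ≈ bit bz
    hhValue-solved bz ba = begin
      (half * bit bz) * ((bit ba + bit (not ba)) + 1#) ≈⟨ *-congˡ (+-congʳ (bit-complement ba)) ⟩
      (half * bit bz) * (1# + 1#)                      ≈⟨ *.xy∙z≈y∙xz half (bit bz) (1# + 1#) ⟩
      bit bz * (half * (1# + 1#))                      ≈⟨ *-congˡ half-inverse ⟩
      bit bz * 1#                                      ≈⟨ *-identityʳ (bit bz) ⟩
      bit bz                                           ∎

    hhTerm-≈ℤ-wireTerm : ∀ σ z y a →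
                         evalR σ (hhTerm z y (con true ⊞ var a)) ≈ℤ evalR σ (wireTerm (wire z y a))
    hhTerm-≈ℤ-wireTerm σ z y a =
      ≈ℤ-respˡ (*-congˡ (+-congʳ (+-congˡ (evalR-hat σ (con true ⊞ var a)))))
               (hhValue-≈ℤ-wireValue (σ z) (bit (σ y)) (σ a))

    hhTerm-solved : ∀ σ {z y a} → z ≢ y → a ≢ y →
                    evalR (σ [ y ≔ σ a ]) (hhTerm z y (con true ⊞ var a)) ≈ bit (σ z)
    hhTerm-solved σ {z} {y} {a} z≢y a≢y = begin
      (half * bit (σ' z)) * ((bit (σ' y) + evalR σ' (hat (con true ⊞ var a))) + 1#)
        ≈⟨ *-congˡ (+-congʳ (+-congˡ (evalR-hat σ' (con true ⊞ var a)))) ⟩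
      (half * bit (σ' z)) * ((bit (σ' y) + bit (not (σ' a))) + 1#)
        ≡⟨ cong₂ (λ p q → (half * bit p) * q) (update-other σ (σ a) z≢y)
                 (cong₂ (λ p q → (bit p + bit (not q)) + 1#) (update-same σ y (σ a))
                        (update-other σ (σ a) a≢y)) ⟩
      (half * bit (σ z)) * ((bit (σ a) + bit (not (σ a))) + 1#)
        ≈⟨ hhValue-solved (σ z) (σ a) ⟩
      bit (σ z) ∎
      where σ' = σ [ y ≔ σ a ]

    renamed-≈ₚ-contractum : ∀ {z y a} R' → z ≢ y → a ≢ y →
      renameE (redirect y a) R' ≈ₚ
      substE y (hat (con true ⊞ (con true ⊞ var a))) (hhTerm z y (con true ⊞ var a) ⊞ R')
    renamed-≈ₚ-contractum {z} {y} {a} R' z≢y a≢y σ =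
      ≈ℤ-respˡ (reflexive (trans (evalR-renameE σ (redirect y a) R') (evalR-cong (∘-redirect-not-not σ y a) R')))
               (≈ℤ-respʳ contractum≈ (≈ℤ-bit+ (σ z) (evalR σ'' R')))
      where
      Q = con true ⊞ var a
      σ'' = σ [ y ≔ not (not (σ a)) ]
      contractum≈ : bit (σ z) + evalR σ'' R' ≈ evalR σ (substE y (hat (con true ⊞ Q)) (hhTerm z y Q ⊞ R'))
      contractum≈ = begin
        bit (σ z) + evalR σ'' R'                   ≈⟨ +-congʳ (hhTerm-solved σ z≢y a≢y) ⟨
        evalR (σ [ y ≔ σ a ]) (hhTerm z y Q) + evalR σ'' R'
          ≡⟨ cong (λ b → evalR (σ [ y ≔ b ]) (hhTerm z y Q) + evalR σ'' R') (sym (not-involutive (σ a))) ⟩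
        evalR σ'' (hhTerm z y Q ⊞ R')
          ≈⟨ evalR-substE-hat σ y (con true ⊞ Q) (hhTerm z y Q ⊞ R') ⟨
        evalR σ (substE y (hat (con true ⊞ Q)) (hhTerm z y Q ⊞ R')) ∎

    -- Up to an integer the wire term is the (HH) redex z/2 (y + hat (1 ⊕ a) + 1), which substitutes
    -- 1 ⊕ (1 ⊕ a), that is a, for y; then z occurs nowhere and (Elim) removes it.
    contractWire : ∀ {n m s K L R' Ph} {O : Vec F2 m} {I : Vec F2 n} z y a →
      K ↭ y ∷ z ∷ L → Unique (y ∷ z ∷ L) → a ∈ L → z ∉ occurring R' O I →
      Ph ≐ wireTerm (wire z y a) ⊞ R' →
      sop s K Ph O I ⟶* sop ((1# + 1#) * s) (remove z (z ∷ L)) (renameE (redirect y a) R')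
                              (Vec.map (renameE (redirect y a)) O) (Vec.map (renameE (redirect y a)) I)
    contractWire {s = s} {K} {L} {R'} {Ph} {O} {I} z y a K↭ y∷z∷L! a∈L z∉ Ph≐ =
      identify ≈-refl K↭ toRedex (λ _ _ → refl) (λ _ _ → refl)
      ◅◅ inj₂ (inj₂ (hh s (y ∷ z ∷ L) R' O I z y Q (there (here refl)) (here refl) (y≢z ∘ sym) z∉redex y∉Q))
      ◅ ε
      ◅◅ identify ≈-refl (↭-reflexive (remove-head (z ∷ L) y∉z∷L)) (renamed-≈ₚ-contractum R' (y≢z ∘ sym) (y≢a ∘ sym))
                  (renamed-≈V-substituted O) (renamed-≈V-substituted I)
      ◅◅ inj₂ (inj₁ (elim s (z ∷ L) _ _ _ z (here refl) z∉renamed)) ◅ ε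
      where
      Q = con true ⊞ var a
      y∉z∷L : y ∉ z ∷ L
      y∉z∷L = Unique[x∷xs]⇒x∉xs y∷z∷L!
      y≢z : y ≢ z
      y≢z = y∉z∷L ∘ here
      y≢a : y ≢ a
      y≢a refl = y∉z∷L (there a∈L)
      z≢a : z ≢ a
      z≢a refl = Unique[x∷xs]⇒x∉xs (drop⁺ 1 y∷z∷L!) a∈L
      z∉redex : z ∉ varsE Q ++ occurring R' O I
      z∉redex (here z≡a) = z≢a z≡a
      z∉redex (there z∈) = z∉ z∈
      y∉Q : y ∉ varsE Q
      y∉Q (here y≡a) = y≢a y≡a
      toRedex : (hhTerm z y Q ⊞ R') ≈ₚ Ph
      toRedex σ = ≈ℤ-respʳ (≈-sym (Ph≐ σ)) (≈ℤ-+ʳ (evalR σ R') (hhTerm-≈ℤ-wireTerm σ z y a))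
      z∉renamed : z ∉ occurring (renameE (redirect y a) R') (Vec.map (renameE (redirect y a)) O)
                                (Vec.map (renameE (redirect y a)) I)
      z∉renamed = subst (z ∉_) (sym (occurring-renameE (redirect y a) R' O I))
                        (∉-map-redirect (occurring R' O I) z≢a z∉)

    contractWires : ∀ {n m} ws {s s' K L L' Rr Ph Ph'} {O O' : Vec F2 m} {I I' : Vec F2 n} →
      K ↭ olds ws ++ guards ws ++ L → Unique (olds ws ++ guards ws ++ L) → All (_∈ L) (news ws) →
      All (_∉ occurring Rr O I) (guards ws) → Ph ≐ wiresTerm ws ⊞ Rr →
      s' ≈ doubled (length ws) s → L ↭ L' → Ph' ≈ₚ renameE (rewire ws) Rr →
      O' ≈V Vec.map (renameE (rewire ws)) O → I' ≈V Vec.map (renameE (rewire ws)) I →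
      sop s K Ph O I ⟶* sop s' L' Ph' O' I'
    contractWires [] {Rr = Rr} {Ph} {Ph'} {O} {O'} {I} {I'} K↭ _ _ _ Ph≐ s'≈ L↭ Ph'≈ O'≈ I'≈ =
      identify s'≈ (↭-trans K↭ L↭)
        (≈ₚ-respʳ {Ph'} {Rr} {Ph} (λ σ → ≈-trans (≈-sym (+-identityˡ _)) (≈-sym (Ph≐ σ)))
                  (subst (Ph' ≈ₚ_) (renameE-id Rr) Ph'≈))
        (subst (O' ≈V_) (map-renameE-id O) O'≈) (subst (I' ≈V_) (map-renameE-id I) I'≈)
    contractWires (wire z y a ∷ ws) {K = K} {L} {Rr = Rr} {Ph} {Ph'} {O} {O'} {I} {I'}
                  K↭ U (a∈L ∷ news∈L) (z∉ ∷ guards∉) Ph≐ s'≈ L↭ Ph'≈ O'≈ I'≈ =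
      contractWire {R' = wiresTerm ws ⊞ Rr} z y a (↭-trans K↭ (↭-prep y z-first)) U′
                   (∈-++⁺ʳ (olds ws) (∈-++⁺ʳ (guards ws) a∈L)) z∉′ Ph≐′
      ◅◅ contractWires ws {Rr = renameE r Rr} (↭-reflexive (remove-head rest z∉rest)) rest! news∈L guards∉′ Ph≐″
           s'≈ L↭
           (subst (Ph' ≈ₚ_) (sym (renameE-∘ (rewire ws) r Rr)) Ph'≈)
           (subst (O' ≈V_) (sym (map-renameE-∘ (rewire ws) r O)) O'≈)
           (subst (I' ≈V_) (sym (map-renameE-∘ (rewire ws) r I)) I'≈)
      where
      rest = olds ws ++ guards ws ++ L
      r = redirect y a
      z-first : olds ws ++ z ∷ guards ws ++ L ↭ z ∷ rest
      z-first = Perm.shift z (olds ws) (guards ws ++ L)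
      U′ : Unique (y ∷ z ∷ rest)
      U′ = Unique-resp-↭ (↭-prep y z-first) U
      rest! : Unique rest
      rest! = drop⁺ 2 U′
      z∉rest : z ∉ rest
      z∉rest = Unique[x∷xs]⇒x∉xs (drop⁺ 1 U′)
      y∉rest : y ∉ rest
      y∉rest = Unique[x∷xs]⇒x∉xs U′ ∘ there
      wires⊆rest : varsE (wiresTerm ws) ⊆ rest
      wires⊆rest =
        ⊆.⊆-trans (varsE-wiresTerm ws) (⊆.++⁺ʳ (olds ws) (⊆.++⁺ʳ (guards ws) (All.lookup news∈L)))
      z∉′ : z ∉ occurring (wiresTerm ws ⊞ Rr) O I
      z∉′ z∈ with ∈-++⁻ (varsE (wiresTerm ws) ++ varsE Rr) z∈
      ... | inj₂ z∈OI = z∉ (∈-++⁺ʳ (varsE Rr) z∈OI)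
      ... | inj₁ z∈′ with ∈-++⁻ (varsE (wiresTerm ws)) z∈′
      ...   | inj₁ z∈W = z∉rest (wires⊆rest z∈W)
      ...   | inj₂ z∈R = z∉ (∈-++⁺ˡ z∈R)
      Ph≐′ : Ph ≐ wireTerm (wire z y a) ⊞ (wiresTerm ws ⊞ Rr)
      Ph≐′ σ = ≈-trans (Ph≐ σ) (+-assoc _ _ _)
      Ph≐″ : renameE r (wiresTerm ws ⊞ Rr) ≐ wiresTerm ws ⊞ renameE r Rr
      Ph≐″ σ = reflexive (cong (λ P → evalR σ (P ⊞ renameE r Rr))
                 (renameE-id-local (wiresTerm ws)
                                   (λ x∈ → redirect-other a (λ { refl → y∉rest (wires⊆rest x∈) }))))
      guards∉′ : All (_∉ occurring (renameE r Rr) (Vec.map (renameE r) O) (Vec.map (renameE r) I)) (guards ws)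
      guards∉′ = All.tabulate λ {x} x∈gs →
        subst (x ∉_) (sym (occurring-renameE r Rr O I))
              (∉-map-redirect _
                 (λ { refl → Unique-++-disjoint (guards ws) (Unique-++ʳ (olds ws) rest!) (x∈gs , a∈L) })
                              (All.lookup guards∉ x∈gs))

    doubled-powR-half : ∀ j a → doubled j (a * powR half j) ≈ a
    doubled-powR-half zero    a = *-identityʳ a
    doubled-powR-half (suc j) a = ≈-trans (doubled-cong j twice-half) (doubled-powR-half j a)
      where
      h = powR half j
      twice-half : (1# + 1#) * (a * (half * h)) ≈ a * h
      twice-half = begin
        (1# + 1#) * (a * (half * h)) ≈⟨ *.x∙yz≈y∙xz (1# + 1#) a (half * h) ⟩
        a * ((1# + 1#) * (half * h)) ≈⟨ *-congˡ (*-assoc (1# + 1#) half h) ⟨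
        a * (((1# + 1#) * half) * h) ≈⟨ *-congˡ (*-congʳ (≈-trans (*-comm (1# + 1#) half) half-inverse)) ⟩
        a * (1# * h)                 ≈⟨ *-congˡ (*-identityˡ h) ⟩
        a * h                        ∎

    -- Contracting the layers of A ∘ D₁ ∘ ⋯ ∘ D_ℓ ∘ B

    module _ {n m} (t : SOP n m) (wf : WF t) where

      V : List ℕ
      V = svars t

      k : ℕ
      k = length V

      Monos⊆V : List Monomial → Set c
      Monos⊆V = All (λ mo → All (_∈ V) (monoVars mo))

      out⊆V : varsV (out t) ⊆ V
      out⊆V = proj₂ wf _ ∘ ∈-++⁺ʳ (varsE (phase t)) ∘ ∈-++⁺ˡ

      inp⊆V : varsV (inp t) ⊆ V
      inp⊆V = proj₂ wf _ ∘ ∈-++⁺ʳ (varsE (phase t)) ∘ ∈-++⁺ʳ (varsV (out t))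

      idVec⊆V : varsV (idVec V) ⊆ V
      idVec⊆V = subst (_⊆ V) (sym (varsV-idVec V)) id

      out-chain : ∀ ms → out (chain t ms) ≡ idVec V
      out-chain []      = refl
      out-chain (_ ∷ _) = refl

      monoExp⊆V : ∀ {mo} → All (_∈ V) (monoVars mo) → varsE (monoExp mo) ⊆ V
      monoExp⊆V {mo} mo⊆V = All.lookup mo⊆V ∘ varsE-monoExp mo

      WF-chain : ∀ ms → Monos⊆V ms → WF (chain t ms)
      WF-chain []        _              = proj₁ wf , λ _ → ++-⊆ idVec⊆V inp⊆V
      WF-chain (mo ∷ ms) (mo⊆V ∷ ms⊆V) = WF-∘ˢ (Dof t mo) (chain t ms) WF-Dof (WF-chain ms ms⊆V)
        where
        WF-Dof : WF (Dof t mo)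
        WF-Dof = proj₁ wf , λ _ → ++-⊆ (monoExp⊆V mo⊆V) (++-⊆ idVec⊆V idVec⊆V)

      outer : Phase → SOP k m
      outer Ph = sop 1# V Ph (out t) (idVec V)

      unshift : ℕ → ℕ → ℕ → ℕ
      unshift M z₀ = rewire (wiresFrom (M +ℕ_) z₀ V)

      unshift-∉ : ∀ {M z₀ x} → x ∉ map (M +ℕ_) V → unshift M z₀ x ≡ x
      unshift-∉ {M} {z₀} {x} x∉ =
        rewire-∉olds (wiresFrom (M +ℕ_) z₀ V) (subst (x ∉_) (sym (olds-wiresFrom (M +ℕ_) z₀ V)) x∉)

      unshift-below : ∀ {M z₀ x} → x < M → unshift M z₀ x ≡ x
      unshift-below {M} = unshift-∉ ∘ ∉-map-+ M V

      unshift-above : ∀ {M N z₀ x} → (∀ {v} → v ∈ V → v < N) → M +ℕ N ≤ x → unshift M z₀ x ≡ x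
      unshift-above {M} V<N M+N≤x = unshift-∉ λ x∈ → case ∈-map⁻ (M +ℕ_) x∈ of λ where
        (v , v∈V , refl) → <⇒≱ (+-monoʳ-< M (V<N v∈V)) M+N≤x

      unshift-shifted : ∀ {M z₀ v} → (∀ {w} → w ∈ V → w < M) → v ∈ V → unshift M z₀ (M +ℕ v) ≡ v
      unshift-shifted {M} {z₀} V<M = rewire-shifted M z₀ V<M

      contractLayer : ∀ (C : SOP n k) rest {s s' Ph M z₀ L' Ph' I'} →
        out C ≡ idVec V → svars C ≡ V ++ rest → WF C →
        (∀ {v} → v ∈ V → v < M) → M ≤ z₀ → (∀ {w} → w ∈ svars C → M +ℕ w < z₀) → varsE Ph ⊆ V →
        s' ≈ doubled k s → V ++ map (M +ℕ_) rest ↭ L' →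
        Ph' ≈ₚ renameE (unshift M z₀) (renameE (M +ℕ_) (phase C) ⊞ Ph) →
        I' ≈V Vec.map (renameE (unshift M z₀)) (Vec.map (renameE (M +ℕ_)) (inp C)) →
        wired s M z₀ (outer Ph) C ⟶* sop s' L' Ph' (out t) I'
      contractLayer C rest {s} {s'} {Ph} {M} {z₀} out≡ svars≡ (C! , C-closed) V<M M≤z₀ C<z₀ Ph⊆V s'≈ L↭ Ph'≈ I'≈ =
        contractWires ws {L = V ++ map (M +ℕ_) rest} {Rr = Rr} K↭ U news∈L guards∉ Ph≐
          (subst (λ j → s' ≈ doubled j s) (sym (length-wiresFrom (M +ℕ_) z₀ V)) s'≈) L↭ Ph'≈
          (≈V-map-renameE-id-local (out t) (unshift-below ∘ V<M ∘ out⊆V)) I'≈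
        where
        ws = wiresFrom (M +ℕ_) z₀ V
        Rr = renameE (M +ℕ_) (phase C) ⊞ Ph
        I = Vec.map (renameE (M +ℕ_)) (inp C)
        K↭ : V ++ map (M +ℕ_) (svars C) ++ zList z₀ k ↭ olds ws ++ guards ws ++ V ++ map (M +ℕ_) rest
        K↭ rewrite svars≡ | olds-wiresFrom (M +ℕ_) z₀ V | guards-wiresFrom (M +ℕ_) z₀ V | map-++ (M +ℕ_) V rest =
          regroup V (map (M +ℕ_) V) (map (M +ℕ_) rest) (zList z₀ k)
        U : Unique (olds ws ++ guards ws ++ V ++ map (M +ℕ_) rest)
        U = Unique-resp-↭ K↭ (Unique-shifted k (proj₁ wf) C! V<M M≤z₀ C<z₀)
        news∈L : All (_∈ V ++ map (M +ℕ_) rest) (news ws)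
        news∈L = subst (All _) (sym (news-wiresFrom (M +ℕ_) z₀ V)) (All.tabulate ∈-++⁺ˡ)
        shifted<z₀ : ∀ {xs} → xs ⊆ svars C → ∀ {x} → x ∈ map (M +ℕ_) xs → x < z₀
        shifted<z₀ xs⊆ x∈ with ∈-map⁻ (M +ℕ_) x∈
        ... | w , w∈ , refl = C<z₀ (xs⊆ w∈)
        V<z₀ : ∀ {x} → x ∈ V → x < z₀
        V<z₀ x∈ = <-≤-trans (V<M x∈) M≤z₀
        occurring<z₀ : ∀ {x} → x ∈ occurring Rr (out t) I → x < z₀
        occurring<z₀ x∈ with ∈-++⁻ (varsE Rr) x∈
        ... | inj₁ x∈Rr with ∈-++⁻ (varsE (renameE (M +ℕ_) (phase C))) x∈Rr
        ...   | inj₁ x∈C  = shifted<z₀ (C-closed _ ∘ ∈-++⁺ˡ) (subst (_ ∈_) (varsE-renameE (M +ℕ_) (phase C)) x∈C)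
        ...   | inj₂ x∈Ph = V<z₀ (Ph⊆V x∈Ph)
        occurring<z₀ x∈ | inj₂ x∈OI with ∈-++⁻ (varsV (out t)) x∈OI
        ...   | inj₁ x∈O = V<z₀ (out⊆V x∈O)
        ...   | inj₂ x∈I = shifted<z₀ (C-closed _ ∘ ∈-++⁺ʳ (varsE (phase C)) ∘ ∈-++⁺ʳ (varsV (out C)))
                                      (subst (_ ∈_) (varsV-renameE (M +ℕ_) (inp C)) x∈I)
        guards∉ : All (_∉ occurring Rr (out t) I) (guards ws)
        guards∉ = subst (All _) (sym (guards-wiresFrom (M +ℕ_) z₀ V))
                        (All.tabulate λ x∈Z x∈ → <⇒≱ (occurring<z₀ x∈) (zList-≥ z₀ k x∈Z))
        zTerms≡ : zTerms z₀ (Vec.map (renameE (M +ℕ_)) (out C)) (idVec V) ≡ wiresTerm ws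
        zTerms≡ = trans (cong (λ O → zTerms z₀ (Vec.map (renameE (M +ℕ_)) O) (idVec V)) out≡) (zTerms-wiresFrom (M +ℕ_) z₀ V)
        Ph≐ : (Rr ⊞ zTerms z₀ (Vec.map (renameE (M +ℕ_)) (out C)) (idVec V)) ≐ wiresTerm ws ⊞ Rr
        Ph≐ σ = ≈-trans (+-comm _ _) (+-congʳ (reflexive (cong (evalR σ) zTerms≡)))

      unshift-beyond : ∀ mo ms {M z₀} x → let N = offset (Dof t mo) (chain t ms) in
                       unshift M z₀ (M +ℕ (N +ℕ x)) ≡ (M +ℕ N) +ℕ x
      unshift-beyond mo ms {M} x =
        trans (unshift-above (svars-<-offsetˡ (Dof t mo) (chain t ms)) (+-monoʳ-≤ M (m≤m+n _ x))) (sym (+ℕ-assoc M _ x))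

      unshift-layer-phase : ∀ mo ms {M z₀ Ph} → (∀ {v} → v ∈ V → v < M) → All (_∈ V) (monoVars mo) → varsE Ph ⊆ V →
        let N = offset (Dof t mo) (chain t ms) in
        renameE (unshift M z₀) (renameE (M +ℕ_) (phase (chain t (mo ∷ ms))) ⊞ Ph)
          ≡ ((renameE ((M +ℕ N) +ℕ_) (phase (chain t ms)) ⊞ monoExp mo)
             ⊞ zTerms (M +ℕ (N +ℕ N)) (Vec.map (renameE ((M +ℕ N) +ℕ_)) (out (chain t ms))) (idVec V)) ⊞ Ph
      unshift-layer-phase mo ms {M} {z₀} {Ph} V<M mo⊆V Ph⊆V =
        cong₂ _⊞_ (trans (renameE-∘ ρ (M +ℕ_) (phase (chain t (mo ∷ ms)))) (cong₂ _⊞_ (cong₂ _⊞_ inner mono) wires))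
                  (renameE-id-local Ph (unshift-below ∘ V<M ∘ Ph⊆V))
        where
        C' = chain t ms
        N = offset (Dof t mo) C'
        ρ = unshift M z₀
        inner : renameE (ρ ∘ (M +ℕ_)) (renameE (N +ℕ_) (phase C')) ≡ renameE ((M +ℕ N) +ℕ_) (phase C')
        inner = trans (renameE-∘ (ρ ∘ (M +ℕ_)) (N +ℕ_) (phase C')) (renameE-cong (unshift-beyond mo ms) (phase C'))
        mono : renameE (ρ ∘ (M +ℕ_)) (monoExp mo) ≡ monoExp mo
        mono = renameE-id-local (monoExp mo) (unshift-shifted V<M ∘ monoExp⊆V mo⊆V)
        guards≡ : map (ρ ∘ (M +ℕ_)) (zList (N +ℕ N) k) ≡ zList (M +ℕ (N +ℕ N)) k
        guards≡ = trans (map-∘ (zList (N +ℕ N) k)) (trans (cong (map ρ) (map-+-zList M (N +ℕ N) k))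
                    (map-id-local (All.tabulate λ x∈ →
                      unshift-above (svars-<-offsetˡ (Dof t mo) C')
                                    (≤-trans (+-monoʳ-≤ M (m≤m+n N N)) (zList-≥ (M +ℕ (N +ℕ N)) k x∈)))))
        wires : renameE (ρ ∘ (M +ℕ_)) (zTerms (N +ℕ N) (Vec.map (renameE (N +ℕ_)) (out C')) (idVec V))
              ≡ zTerms (M +ℕ (N +ℕ N)) (Vec.map (renameE ((M +ℕ N) +ℕ_)) (out C')) (idVec V)
        wires = renameE-zTerms V (out-chain ms) (map-cong (unshift-beyond mo ms) V)
                               (map-id-local (All.tabulate (unshift-shifted V<M))) guards≡

      unshift-layer-inp : ∀ mo ms {M z₀} → let N = offset (Dof t mo) (chain t ms) in
        Vec.map (renameE (unshift M z₀)) (Vec.map (renameE (M +ℕ_)) (inp (chain t (mo ∷ ms))))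
          ≡ Vec.map (renameE ((M +ℕ N) +ℕ_)) (inp (chain t ms))
      unshift-layer-inp mo ms {M} {z₀} =
        trans (map-renameE-∘ (unshift M z₀) (M +ℕ_) _)
              (trans (map-renameE-∘ (unshift M z₀ ∘ (M +ℕ_)) (_ +ℕ_) (inp (chain t ms)))
                     (VecP.map-cong (renameE-cong (unshift-beyond mo ms)) (inp (chain t ms))))

      reduceChain : ∀ ms {s Ph M z₀} → Monos⊆V ms →
        (∀ {v} → v ∈ V → v < M) → M ≤ z₀ → (∀ {w} → w ∈ svars (chain t ms) → M +ℕ w < z₀) → varsE Ph ⊆ V →
        s ≈ (scalar t * scalar (chain t ms)) * powR half k → phase t ≈ₚ (Ph ⊞ sumMonos ms) →
        wired s M z₀ (outer Ph) (chain t ms) ⟶* t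
      reduceChain [] {s} {Ph} {M} {z₀} _ V<M M≤z₀ C<z₀ Ph⊆V s≈ phase≈ =
        contractLayer (Bof t) [] refl (sym (++-identityʳ V)) (WF-chain [] []) V<M M≤z₀ C<z₀ Ph⊆V
          (≈-sym (≈-trans (doubled-cong k s≈) (≈-trans (doubled-powR-half k _) (*-identityʳ (scalar t)))))
          (↭-reflexive (++-identityʳ V))
          (subst (λ P → phase t ≈ₚ (con 0# ⊞ P)) (sym (renameE-id-local Ph (unshift-below ∘ V<M ∘ Ph⊆V)))
                 (≈ₚ-respʳ {phase t} {Ph ⊞ con 0#} {con 0# ⊞ Ph} (λ σ → +-comm _ _) phase≈))
          (subst (inp t ≈V_) (sym (map-renameE-∘ (unshift M z₀) (M +ℕ_) (inp t)))
                 (≈V-map-renameE-id-local (inp t) (unshift-shifted V<M ∘ inp⊆V)))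
      reduceChain (mo ∷ ms) {s} {Ph} {M} {z₀} (mo⊆V ∷ ms⊆V) V<M M≤z₀ C<z₀ Ph⊆V s≈ phase≈ =
        contractLayer (chain t (mo ∷ ms)) (map (N +ℕ_) (svars C') ++ zList (N +ℕ N) k) refl refl
          (WF-chain (mo ∷ ms) (mo⊆V ∷ ms⊆V)) V<M M≤z₀ C<z₀ Ph⊆V ≈-refl svars↭ phase≈ₚ
          (≡⇒≈V (sym (unshift-layer-inp mo ms {M} {z₀})))
        ◅◅ reduceChain ms {doubled k s} {Ph ⊞ monoExp mo} {M +ℕ N} {M +ℕ (N +ℕ N)} ms⊆V
             (λ v∈ → <-≤-trans (V<M v∈) (m≤m+n M N)) (+-monoʳ-≤ M (m≤m+n N N)) C'<
             (++-⊆ Ph⊆V (monoExp⊆V mo⊆V)) scalar≈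
             (≈ₚ-respʳ {phase t} {Ph ⊞ sumMonos (mo ∷ ms)} {(Ph ⊞ monoExp mo) ⊞ sumMonos ms}
                       (λ σ → ≈-sym (+-assoc _ _ _)) phase≈)
        where
        C' = chain t ms
        N = offset (Dof t mo) C'
        A = renameE ((M +ℕ N) +ℕ_) (phase C')
        Z = zTerms (M +ℕ (N +ℕ N)) (Vec.map (renameE ((M +ℕ N) +ℕ_)) (out C')) (idVec V)
        svars↭ : V ++ map (M +ℕ_) (map (N +ℕ_) (svars C') ++ zList (N +ℕ N) k)
               ↭ V ++ map ((M +ℕ N) +ℕ_) (svars C') ++ zList (M +ℕ (N +ℕ N)) k
        svars↭ = ↭-reflexive (cong (V ++_)
          (trans (map-++ (M +ℕ_) (map (N +ℕ_) (svars C')) (zList (N +ℕ N) k))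
                 (cong₂ _++_ (map-+-map-+ M N (svars C')) (map-+-zList M (N +ℕ N) k))))
        rearrange : ∀ a p q z → (a + (p + q)) + z ≈ ((a + q) + z) + p
        rearrange a p q z =
          ≈-trans (+-congʳ (≈-trans (+-congˡ (+-comm p q)) (≈-sym (+-assoc a q p)))) (+.xy∙z≈xz∙y (a + q) p z)
        phase≈ₚ : ((A ⊞ (Ph ⊞ monoExp mo)) ⊞ Z) ≈ₚ
                  renameE (unshift M z₀) (renameE (M +ℕ_) (phase (chain t (mo ∷ ms))) ⊞ Ph)
        phase≈ₚ = subst (((A ⊞ (Ph ⊞ monoExp mo)) ⊞ Z) ≈ₚ_)
                        (sym (unshift-layer-phase mo ms {M} {z₀} {Ph} V<M mo⊆V Ph⊆V))
                        (≐⇒≈ₚ {(A ⊞ (Ph ⊞ monoExp mo)) ⊞ Z} {((A ⊞ monoExp mo) ⊞ Z) ⊞ Ph} (λ σ → rearrange _ _ _ _))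
        C'< : ∀ {w} → w ∈ svars C' → (M +ℕ N) +ℕ w < M +ℕ (N +ℕ N)
        C'< {w} w∈ = subst (_< M +ℕ (N +ℕ N)) (sym (+ℕ-assoc M N w))
                           (+-monoʳ-< M (+-monoʳ-< N (svars-<-offsetʳ (Dof t mo) C' w∈)))
        scalar≈ : doubled k s ≈ (scalar t * scalar C') * powR half k
        scalar≈ = ≈-trans (doubled-cong k s≈) (≈-trans (doubled-powR-half k _)
                    (≈-trans (*-congˡ (*-congʳ (*-identityˡ (scalar C')))) (≈-sym (*-assoc _ _ _))))

lemma6p2 : ∀ {c ℓ} (R : CommutativeRing c ℓ) (half : CommutativeRing.Carrier R) →
           let open CommutativeRing R in
           half * (1# + 1#) ≈ 1# →
           let open SOPTheory R half in
           ∀ {n m} (t : SOP n m) → WF t → 0 < length (svars t) →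
           (ms : List Monomial) →
           All (λ mo → All (_∈ svars t) (monoVars mo)) ms →
           phase t ≈ₚ sumMonos ms →
           (Aof t ∘ˢ chain t ms) ⟶* t
lemma6p2 R half half-inverse t wf _ ms ms⊆V phase≈ =
  reduceChain half-inverse t wf ms ms⊆V
    (svars-<-offsetˡ (Aof t) C) (m≤m+n N N) (+-monoʳ-< N ∘ svars-<-offsetʳ (Aof t) C) (λ ())
    ≈-refl (≈ₚ-respʳ {phase t} {sumMonos ms} {con 0# ⊞ sumMonos ms} (λ σ → ≈-sym (+-identityˡ _)) phase≈)
  where
  open CommutativeRing R using (0#; +-identityˡ) renaming (refl to ≈-refl; sym to ≈-sym)
  open SOPTheory R half
  open Reduction R half
  C = chain t ms
  N = offset (Aof t) C
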